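{- For every integer $d\ge 5$, $\mu(Q_d)\le 2^{d-1}$.
   Context: For a connected graph $G$ and $X\subseteq V(G)$, two vertices $x,y\in V(G)$ are $X$-visible if there is a shortest $x,y$-path none of whose internal vertices lies in $X$. $X$ is a mutual-visibility set if every two vertices of $X$ are $X$-visible; $\mu(G)$ is the maximum cardinality of a mutual-visibility set of $G$. The hypercube $Q_d$ has vertex set $\{0,1\}^d$, two binary strings being adjacent if and only if they differ in exactly one position. -}

module Defs where

open import Data.Nat using (ℕ; zero; suc; _≤_)
open import Data.Bool using (Bool; not)
open import Data.Vec using (Vec; updateAt)
open import Data.Fin using (Fin)
open import Data.List using (List)
open import Data.List.Membership.Propositional using (_∈_; _∉_)
open import Data.Product using (Σ; ∃; _×_)
open import Data.Sum using (_⊎_)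
open import Data.Empty using (⊥)
open import Relation.Binary.PropositionalEquality using (_≡_)

V : ℕ → Set
V d = Vec Bool d

Adj : ∀ {d} → V d → V d → Set
Adj {d} u v = ∃ λ (i : Fin d) → v ≡ updateAt u i not

data Walk {d : ℕ} : V d → V d → ℕ → Set where
  []   : ∀ {x} → Walk x x 0
  step : ∀ {x z y n} → Adj x z → Walk z y n → Walk x y (suc n)

Shortest : ∀ {d} {x y : V d} {n} → Walk x y n → Set
Shortest {d} {x} {y} {n} _ = ∀ m → Walk x y m → n ≤ m

Internal : ∀ {d} {x y : V d} {n} → Walk x y n → V d → Set
Internal [] v = ⊥
Internal (step a []) v = ⊥
Internal (step {z = z} a w@(step _ _)) v = (v ≡ z) ⊎ Internal w v

Visible : ∀ {d} → List (V d) → V d → V d → Set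
Visible X x y =
  ∃ λ n → Σ (Walk x y n) λ w → Shortest w × (∀ v → Internal w v → v ∉ X)

MutualVisibility : ∀ {d} → List (V d) → Set
MutualVisibility X = ∀ x y → x ∈ X → y ∈ X → Visible X x y

-- A shortest path in Q_d corrects one differing coordinate per step, so visibility can be
-- recast inductively, one coordinate flip at a time.  Such a path between two vertices with
-- the same first coordinate never changes it; hence each half {v | v₀ = b} of a
-- mutual-visibility set of Q_(d+1) is one of Q_d, and the bound doubles with each dimension.
-- It remains to show μ(Q_5) ≤ 16: seventeen vertices put at least nine on one side of each of
-- the first two coordinates, and for each of the four choices of sides an exhaustive
-- branch-and-bound search, evaluated by the type checker, finds no mutual-visibility set.
module Submission where

open import Defs
open import Data.Nat
  using (ℕ; _≤_; _^_; _∸_; zero; suc; pred; _+_; _*_; _<_; z≤n; s≤s; _<ᵇ_; _≤ᵇ_; _<?_)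
open import Data.Nat.Properties
  using (≤-refl; ≤-trans; ≤-antisym; ≤-reflexive; ≤-pred; n≤1+n; 1+n≰n; >⇒≢; suc-injective;
         +-suc; +-identityʳ; +-mono-≤; ≮⇒≥; <⇒≱; <ᵇ⇒<; ≤⇒≤ᵇ; m≤n+o⇒m∸n≤o; m≤n⇒∃[o]m+o≡n;
         module ≤-Reasoning)
open import Data.Bool using (Bool; true; false; not; _∧_; _∨_; _xor_; if_then_else_; T; T?)
  renaming (_≟_ to _≟ᵇ_)
open import Data.Bool.Properties using (T-∧; T-∨; T-≡)
open import Data.Unit using (tt)
open import Data.Vec using ([]; _∷_; updateAt; lookup)
open import Data.Vec.Properties using (≡-dec)
open import Data.Fin using (Fin; zero; suc)
open import Data.List using (List; []; _∷_; _++_; length; map; filter; filterᵇ)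
open import Data.Bool.ListAction using (any)
open import Data.List.Properties using (length-++-sucʳ; filter-all)
open import Data.List.Membership.Propositional using (_∈_; _∉_; lose)
open import Data.List.Membership.Propositional.Properties
  using (∈-map⁺; ∈-++⁺ˡ; ∈-++⁺ʳ; ∈-++⁻; ∈-∃++; ∈-filter⁺; ∈-filter⁻)
open import Data.List.Relation.Unary.Any using (here; there; any?)
open import Data.List.Relation.Unary.Any.Properties using (any⁺; any⁻)
open import Data.List.Relation.Unary.All as All using (All; []; _∷_)
open import Data.List.Relation.Unary.AllPairs using ([]; _∷_)
open import Data.List.Relation.Unary.Unique.Propositional using (Unique)
import Data.List.Relation.Unary.Unique.Propositional.Properties as Unique
open import Data.List.Relation.Unary.All.Properties using (map⁺)
open import Data.List.Relation.Binary.Sublist.Propositional.Properties as Sublist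
  using (length-mono-≤)
open import Data.List.Relation.Binary.Sublist.Propositional using (_⊆_; ⊆-refl)
open import Data.Product using (∃; _×_; _,_; proj₂)
open import Data.Sum as Sum using (_⊎_; inj₁; inj₂)
open import Data.Empty using (⊥; ⊥-elim)
open import Function using (_∘_; Equivalence)
open Equivalence using (to; from)
open import Relation.Nullary using (¬_; Dec; yes; no; contradiction)
open import Relation.Nullary.Decidable using (_×-dec_)
open import Relation.Binary.PropositionalEquality

T-not⇒¬T : ∀ {b} → T (not b) → ¬ T b
T-not⇒¬T {false} _ ()

¬T⇒T-not : ∀ {b} → ¬ T b → T (not b)
¬T⇒T-not {true} ¬t = ¬t tt
¬T⇒T-not {false} _ = tt

unique-⊆⇒length-≤ : ∀ {A : Set} {xs ys : List A} → Unique xs → (∀ {x} → x ∈ xs → x ∈ ys) →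
  length xs ≤ length ys
unique-⊆⇒length-≤ {xs = []} _ _ = z≤n
unique-⊆⇒length-≤ {xs = x ∷ xs} (x∉xs ∷ unique) sub with ∈-∃++ (sub (here refl))
... | ys , zs , refl = begin
  suc (length xs)        ≤⟨ s≤s (unique-⊆⇒length-≤ unique sub′) ⟩
  suc (length (ys ++ zs)) ≡⟨ length-++-sucʳ ys x zs ⟨
  length (ys ++ x ∷ zs)  ∎
  where
    open ≤-Reasoning
    sub′ : ∀ {v} → v ∈ xs → v ∈ ys ++ zs
    sub′ v∈xs with ∈-++⁻ ys (sub (there v∈xs))
    ... | inj₁ v∈ys = ∈-++⁺ˡ v∈ys
    ... | inj₂ (here refl) = contradiction refl (All.lookup x∉xs v∈xs)
    ... | inj₂ (there v∈zs) = ∈-++⁺ʳ ys v∈zs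

length-filterᵇ-split : ∀ {A : Set} (p : A → Bool) (xs : List A) →
  length xs ≡ length (filterᵇ p xs) + length (filterᵇ (not ∘ p) xs)
length-filterᵇ-split p [] = refl
length-filterᵇ-split p (x ∷ xs) with p x
... | true = cong suc (length-filterᵇ-split p xs)
... | false = trans (cong suc (length-filterᵇ-split p xs)) (sym (+-suc _ _))

pigeonhole : ∀ k {m n} → k + k < m + n → k < m ⊎ k < n
pigeonhole k {m} {n} k+k<m+n with k <? m | k <? n
... | yes k<m | _ = inj₁ k<m
... | no _ | yes k<n = inj₂ k<n
... | no k≮m | no k≮n = contradiction (+-mono-≤ (≮⇒≥ k≮m) (≮⇒≥ k≮n)) (<⇒≱ k+k<m+n)

¬T-any : ∀ {A : Set} {P : A → Set} {f : A → Bool} {xs} → All P xs → (∀ {x} → P x → ¬ T (f x)) →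
  ¬ T (any f xs)
¬T-any {f = f} {xs} all refute t with All.lookupAny all (any⁻ f xs t)
... | px , tx = refute px tx

flipAt : ∀ {d} → V d → Fin d → V d
flipAt x i = updateAt x i not

distance : ∀ {d} → V d → V d → ℕ
distance [] [] = 0
distance (a ∷ x) (b ∷ y) = if a xor b then suc (distance x y) else distance x y

distance-self : ∀ {d} (x : V d) → distance x x ≡ 0
distance-self [] = refl
distance-self (false ∷ x) = distance-self x
distance-self (true ∷ x) = distance-self x

distance-≤-dim : ∀ {d} (x y : V d) → distance x y ≤ d
distance-≤-dim [] [] = z≤n
distance-≤-dim (false ∷ x) (false ∷ y) = ≤-trans (distance-≤-dim x y) (n≤1+n _)
distance-≤-dim (false ∷ x) (true ∷ y) = s≤s (distance-≤-dim x y)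
distance-≤-dim (true ∷ x) (false ∷ y) = s≤s (distance-≤-dim x y)
distance-≤-dim (true ∷ x) (true ∷ y) = ≤-trans (distance-≤-dim x y) (n≤1+n _)

distance-flipAt : ∀ {d} (x y : V d) (i : Fin d) →
  suc (distance (flipAt x i) y) ≡ distance x y ⊎ distance (flipAt x i) y ≡ suc (distance x y)
distance-flipAt (false ∷ x) (false ∷ y) zero = inj₂ refl
distance-flipAt (false ∷ x) (true ∷ y) zero = inj₁ refl
distance-flipAt (true ∷ x) (false ∷ y) zero = inj₁ refl
distance-flipAt (true ∷ x) (true ∷ y) zero = inj₂ refl
distance-flipAt (false ∷ x) (false ∷ y) (suc i) = distance-flipAt x y i
distance-flipAt (false ∷ x) (true ∷ y) (suc i) = Sum.map (cong suc) (cong suc) (distance-flipAt x y i)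
distance-flipAt (true ∷ x) (false ∷ y) (suc i) = Sum.map (cong suc) (cong suc) (distance-flipAt x y i)
distance-flipAt (true ∷ x) (true ∷ y) (suc i) = distance-flipAt x y i

distance-≤-length : ∀ {d} {x y : V d} {n} → Walk x y n → distance x y ≤ n
distance-≤-length {x = x} [] = ≤-reflexive (distance-self x)
distance-≤-length {x = x} {y} (step (i , refl) w) with distance-flipAt x y i
... | inj₁ closer = ≤-trans (≤-reflexive (sym closer)) (s≤s (distance-≤-length w))
... | inj₂ farther =
  ≤-trans (n≤1+n _) (≤-trans (≤-reflexive (sym farther)) (≤-trans (distance-≤-length w) (n≤1+n _)))

cons-walk : ∀ {d} {x y : V d} {n} (a : Bool) → Walk x y n → Walk (a ∷ x) (a ∷ y) n
cons-walk a [] = []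
cons-walk a (step (i , refl) w) = step (suc i , refl) (cons-walk a w)

geodesic : ∀ {d} (x y : V d) → Walk x y (distance x y)
geodesic [] [] = []
geodesic (false ∷ x) (false ∷ y) = cons-walk false (geodesic x y)
geodesic (true ∷ x) (true ∷ y) = cons-walk true (geodesic x y)
geodesic (false ∷ x) (true ∷ y) = step (zero , refl) (cons-walk true (geodesic x y))
geodesic (true ∷ x) (false ∷ y) = step (zero , refl) (cons-walk false (geodesic x y))

shortest⇒length≡distance : ∀ {d} {x y : V d} {n} (w : Walk x y n) → Shortest w → n ≡ distance x y
shortest⇒length≡distance {x = x} {y} w shortest =
  ≤-antisym (shortest _ (geodesic x y)) (distance-≤-length w)

data MonoVisible {d : ℕ} (B : V d → Set) : V d → V d → Set where
  near : ∀ {x y} → distance x y ≤ 1 → MonoVisible B x y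
  flip-toward : ∀ {x y} (i : Fin d) → suc (distance (flipAt x i) y) ≡ distance x y →
    ¬ B (flipAt x i) → MonoVisible B (flipAt x i) y → MonoVisible B x y

MonoMutualVisibility : ∀ {d} → List (V d) → Set
MonoMutualVisibility X = ∀ {x y} → x ∈ X → y ∈ X → MonoVisible (_∈ X) x y

geodesic-descends : ∀ {d} {x y : V d} {n} (i : Fin d) → Walk (flipAt x i) y n →
  suc n ≡ distance x y → suc (distance (flipAt x i) y) ≡ distance x y
geodesic-descends {x = x} {y} i w short with distance-flipAt x y i
... | inj₁ closer = closer
... | inj₂ farther = contradiction
  (≤-trans (n≤1+n _)
    (≤-trans (≤-reflexive (trans (cong suc short) (sym farther))) (distance-≤-length w)))
  1+n≰n

geodesic⇒monoVisible : ∀ {d} {X : List (V d)} {x y : V d} {n} (w : Walk x y n) →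
  n ≡ distance x y → (∀ v → Internal w v → v ∉ X) → MonoVisible (_∈ X) x y
geodesic⇒monoVisible [] short _ = near (subst (_≤ 1) short z≤n)
geodesic⇒monoVisible (step _ []) short _ = near (subst (_≤ 1) short ≤-refl)
geodesic⇒monoVisible (step (i , refl) w@(step _ _)) short avoids =
  flip-toward i (geodesic-descends i w short) (avoids _ (inj₁ refl))
    (geodesic⇒monoVisible w (suc-injective (trans short (sym (geodesic-descends i w short))))
      (λ v → avoids v ∘ inj₂))

mutualVisibility⇒mono : ∀ {d} {X : List (V d)} → MutualVisibility X → MonoMutualVisibility X
mutualVisibility⇒mono mv x∈X y∈X with mv _ _ x∈X y∈X
... | _ , w , shortest , avoids =
  geodesic⇒monoVisible w (shortest⇒length≡distance w shortest) avoids

monoVisible-mono : ∀ {d} {B B′ : V d → Set} {x y} → (∀ {v} → B′ v → B v) →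
  MonoVisible B x y → MonoVisible B′ x y
monoVisible-mono sub (near h) = near h
monoVisible-mono sub (flip-toward i closer ∉B m) =
  flip-toward i closer (∉B ∘ sub) (monoVisible-mono sub m)

-- A path that keeps approaching b ∷ y never flips the head b: that would move away.
monoVisible-tail : ∀ {d} {B : V (suc d) → Set} (b : Bool) {x y : V d} →
  MonoVisible B (b ∷ x) (b ∷ y) → MonoVisible (B ∘ (b ∷_)) x y
monoVisible-tail false (near h) = near h
monoVisible-tail true (near h) = near h
monoVisible-tail false (flip-toward zero closer _ _) = ⊥-elim (>⇒≢ (s≤s (n≤1+n _)) closer)
monoVisible-tail true (flip-toward zero closer _ _) = ⊥-elim (>⇒≢ (s≤s (n≤1+n _)) closer)
monoVisible-tail false (flip-toward (suc i) closer ∉B m) =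
  flip-toward i closer ∉B (monoVisible-tail false m)
monoVisible-tail true (flip-toward (suc i) closer ∉B m) =
  flip-toward i closer ∉B (monoVisible-tail true m)

slice : ∀ {d} → Bool → List (V (suc d)) → List (V d)
slice b [] = []
slice b ((a ∷ v) ∷ X) with a ≟ᵇ b
... | yes _ = v ∷ slice b X
... | no _ = slice b X

∈-slice⁻ : ∀ {d} b (X : List (V (suc d))) {v} → v ∈ slice b X → (b ∷ v) ∈ X
∈-slice⁻ b ((a ∷ u) ∷ X) v∈ with a ≟ᵇ b
∈-slice⁻ b ((a ∷ u) ∷ X) (here refl) | yes refl = here refl
∈-slice⁻ b ((a ∷ u) ∷ X) (there v∈) | yes refl = there (∈-slice⁻ b X v∈)
∈-slice⁻ b ((a ∷ u) ∷ X) v∈ | no _ = there (∈-slice⁻ b X v∈)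

slice-unique : ∀ {d} b {X : List (V (suc d))} → Unique X → Unique (slice b X)
slice-unique b [] = []
slice-unique b {(a ∷ u) ∷ X} (u∉ ∷ unique) with a ≟ᵇ b
... | yes refl = All.tabulate (λ v∈ u≡v → All.lookup u∉ (∈-slice⁻ b X v∈) (cong (b ∷_) u≡v))
                 ∷ slice-unique b unique
... | no _ = slice-unique b unique

slice-monoMutualVisibility : ∀ {d} b {X : List (V (suc d))} →
  MonoMutualVisibility X → MonoMutualVisibility (slice b X)
slice-monoMutualVisibility b {X} mv x∈ y∈ =
  monoVisible-mono (∈-slice⁻ b X) (monoVisible-tail b (mv (∈-slice⁻ b X x∈) (∈-slice⁻ b X y∈)))

length-slices : ∀ {d} (X : List (V (suc d))) →
  length X ≡ length (slice true X) + length (slice false X)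
length-slices [] = refl
length-slices ((true ∷ v) ∷ X) = cong suc (length-slices X)
length-slices ((false ∷ v) ∷ X) = trans (cong suc (length-slices X)) (sym (+-suc _ _))

double-bound : ∀ {d} {m} → (∀ (Y : List (V d)) → Unique Y → MonoMutualVisibility Y → length Y ≤ m) →
  ∀ (X : List (V (suc d))) → Unique X → MonoMutualVisibility X → length X ≤ 2 * m
double-bound {m = m} bound X unique mv = begin
  length X                                       ≡⟨ length-slices X ⟩
  length (slice true X) + length (slice false X) ≤⟨ +-mono-≤ (half true) (half false) ⟩
  m + m                                          ≡⟨ cong (m +_) (sym (+-identityʳ m)) ⟩
  2 * m                                          ∎
  where
    open ≤-Reasoning
    half : ∀ b → length (slice b X) ≤ m
    half b = bound (slice b X) (slice-unique b unique) (slice-monoMutualVisibility b mv)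

-- Sets of vertices as complete binary tries, for fast membership tests during the search.
data Trie : ℕ → Set where
  leaf : Bool → Trie zero
  node : ∀ {n} → Trie n → Trie n → Trie (suc n)

empty : ∀ n → Trie n
empty zero = leaf false
empty (suc n) = node (empty n) (empty n)

member : ∀ {n} → V n → Trie n → Bool
member [] (leaf b) = b
member (false ∷ v) (node l r) = member v l
member (true ∷ v) (node l r) = member v r

insert : ∀ {n} → V n → Trie n → Trie n
insert [] (leaf _) = leaf true
insert (false ∷ v) (node l r) = node (insert v l) r
insert (true ∷ v) (node l r) = node l (insert v r)

_⊑_ : ∀ {n} → Trie n → List (V n) → Set
S ⊑ X = ∀ {u} → T (member u S) → u ∈ X

empty-⊑ : ∀ {n} {X : List (V n)} → empty n ⊑ X
empty-⊑ {u = u} = ⊥-elim ∘ member-empty u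
  where
    member-empty : ∀ {n} (u : V n) → ¬ T (member u (empty n))
    member-empty [] ()
    member-empty (false ∷ u) = member-empty u
    member-empty (true ∷ u) = member-empty u

member-insert⁻ : ∀ {n} (u v : V n) (S : Trie n) → T (member u (insert v S)) → u ≡ v ⊎ T (member u S)
member-insert⁻ [] [] (leaf _) _ = inj₁ refl
member-insert⁻ (false ∷ u) (false ∷ v) (node l r) t =
  Sum.map₁ (cong (false ∷_)) (member-insert⁻ u v l t)
member-insert⁻ (false ∷ u) (true ∷ v) (node l r) t = inj₂ t
member-insert⁻ (true ∷ u) (false ∷ v) (node l r) t = inj₂ t
member-insert⁻ (true ∷ u) (true ∷ v) (node l r) t =
  Sum.map₁ (cong (true ∷_)) (member-insert⁻ u v r t)

insert-⊑ : ∀ {n} {X : List (V n)} {v S} → v ∈ X → S ⊑ X → insert v S ⊑ X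
insert-⊑ {v = v} {S} v∈X S⊑X {u} t with member-insert⁻ u v S t
... | inj₁ refl = v∈X
... | inj₂ u∈S = S⊑X u∈S

differences : ∀ {n} → V n → V n → List (Fin n)
differences [] [] = []
differences (a ∷ x) (b ∷ y) =
  if a xor b then zero ∷ map suc (differences x y) else map suc (differences x y)

closer⇒∈-differences : ∀ {n} (x y : V n) (i : Fin n) →
  suc (distance (flipAt x i) y) ≡ distance x y → i ∈ differences x y
closer⇒∈-differences (false ∷ x) (true ∷ y) zero _ = here refl
closer⇒∈-differences (true ∷ x) (false ∷ y) zero _ = here refl
closer⇒∈-differences (false ∷ x) (false ∷ y) zero closer = ⊥-elim (>⇒≢ (s≤s (n≤1+n _)) closer)
closer⇒∈-differences (true ∷ x) (true ∷ y) zero closer = ⊥-elim (>⇒≢ (s≤s (n≤1+n _)) closer)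
closer⇒∈-differences (false ∷ x) (false ∷ y) (suc i) closer =
  ∈-map⁺ suc (closer⇒∈-differences x y i closer)
closer⇒∈-differences (true ∷ x) (true ∷ y) (suc i) closer =
  ∈-map⁺ suc (closer⇒∈-differences x y i closer)
closer⇒∈-differences (false ∷ x) (true ∷ y) (suc i) closer =
  there (∈-map⁺ suc (closer⇒∈-differences x y i (suc-injective closer)))
closer⇒∈-differences (true ∷ x) (false ∷ y) (suc i) closer =
  there (∈-map⁺ suc (closer⇒∈-differences x y i (suc-injective closer)))

monoVisibleᵇ : ∀ {n} → ℕ → Trie n → V n → V n → Bool
monoVisibleᵇ zero S x y = distance x y ≤ᵇ 1
monoVisibleᵇ (suc f) S x y = (distance x y ≤ᵇ 1) ∨
  any (λ i → not (member (flipAt x i) S) ∧ monoVisibleᵇ f S (flipAt x i) y) (differences x y)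

monoVisibleᵇ-complete : ∀ {n} {B : V n → Set} {S x y} (f : ℕ) → distance x y ≤ f →
  (∀ {u} → T (member u S) → B u) → MonoVisible B x y → T (monoVisibleᵇ f S x y)
monoVisibleᵇ-complete zero _ _ (near h) = ≤⇒≤ᵇ h
monoVisibleᵇ-complete (suc f) _ _ (near h) = from T-∨ (inj₁ (≤⇒≤ᵇ h))
monoVisibleᵇ-complete zero h _ (flip-toward i closer _ _) =
  contradiction (subst (_≤ 0) (sym closer) h) λ ()
monoVisibleᵇ-complete {S = S} {x} {y} (suc f) h S⊆B (flip-toward i closer ∉B m) =
  from T-∨ (inj₂ (any⁺ _ (lose (closer⇒∈-differences x y i closer) onward)))
  where
    onward : T (not (member (flipAt x i) S) ∧ monoVisibleᵇ f S (flipAt x i) y)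
    onward = from T-∧
      ( ¬T⇒T-not (∉B ∘ S⊆B)
      , monoVisibleᵇ-complete f (≤-pred (subst (_≤ suc f) (sym closer) h)) S⊆B m)

-- v lies in the interval between x and y, i.e. on some geodesic from x to y.
between : ∀ {n} → V n → V n → V n → Bool
between [] [] [] = true
between (a ∷ v) (b ∷ x) (c ∷ y) = (if b xor c then true else not (a xor b)) ∧ between v x y

-- Only pairs whose interval contains the newly added vertex v are tested: no other pair
-- can have been affected.
blockedPairs : ∀ {n} → Trie n → V n → List (V n) → Bool
blockedPairs S v [] = false
blockedPairs {n} S v (x ∷ xs) =
  any (λ y → between v x y ∧ not (monoVisibleᵇ n S x y)) xs ∨ blockedPairs S v xs

blocked : ∀ {n} → Trie n → V n → List (V n) → Bool
blocked {n} S v xs = any (λ x → not (monoVisibleᵇ n S x v)) xs ∨ blockedPairs S v xs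

-- A demand (p , k) asks for at least k chosen vertices satisfying p.
Demand : ℕ → Set
Demand n = (V n → Bool) × ℕ

unmet : ∀ {n} → List (V n) → Demand n → Bool
unmet rest (p , k) = length (filterᵇ p rest) <ᵇ k

choose : ∀ {n} → V n → Demand n → Demand n
choose v (p , k) = p , (if p v then pred k else k)

-- Branch and bound: each candidate is either chosen (recorded both in the trie S and in the
-- list xs) or skipped; true means that every branch dies on an unmet demand or a blocked pair.
search : ∀ {n} → List (Demand n) → List (V n) → Trie n → List (V n) → Bool
search ds [] S xs = any (unmet []) ds
search ds (v ∷ rest) S xs = any (unmet (v ∷ rest)) ds ∨
  ((blocked (insert v S) v xs ∨ search (map (choose v) ds) rest (insert v S) (v ∷ xs))
   ∧ search ds rest S xs)

_∈?_ : ∀ {n} (v : V n) (X : List (V n)) → Dec (v ∈ X)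
v ∈? X = any? (≡-dec _≟ᵇ_ v) X

inside? : ∀ {n} (X : List (V n)) (p : V n → Bool) (v : V n) → Dec (v ∈ X × T (p v))
inside? X p v = v ∈? X ×-dec T? (p v)

MeetsDemand : ∀ {n} → List (V n) → Demand n → Set
MeetsDemand X (p , k) = k ≤ length (filterᵇ p X)

CanMeet : ∀ {n} → List (V n) → List (V n) → Demand n → Set
CanMeet X rest (p , k) = k ≤ length (filter (inside? X p) rest)

unmet-sound : ∀ {n} {X : List (V n)} rest d → CanMeet X rest d → ¬ T (unmet rest d)
unmet-sound {X = X} rest (p , k) canMeet t =
  <⇒≱ (<ᵇ⇒< _ _ t) (≤-trans canMeet (length-mono-≤ fewer))
  where
    fewer : filter (inside? X p) rest ⊆ filterᵇ p rest
    fewer = Sublist.filter⁺ (inside? X p) (T? ∘ p) (λ { refl → proj₂ }) (⊆-refl {x = rest})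

canMeet-skip : ∀ {n} {X rest : List (V n)} {v} d → v ∉ X → CanMeet X (v ∷ rest) d → CanMeet X rest d
canMeet-skip {X = X} {v = v} (p , k) v∉X canMeet with v ∈? X
... | yes v∈X = contradiction v∈X v∉X
... | no _ = canMeet

canMeet-choose : ∀ {n} {X rest : List (V n)} {v} d → v ∈ X → CanMeet X (v ∷ rest) d →
  CanMeet X rest (choose v d)
canMeet-choose {X = X} {v = v} (p , k) v∈X canMeet with v ∈? X | p v
... | no v∉X | _ = contradiction v∈X v∉X
... | yes _ | true = m≤n+o⇒m∸n≤o k 1 canMeet
... | yes _ | false = canMeet

module _ {n} {X : List (V n)} (mv : MonoMutualVisibility X) where

  visibility-checked : ∀ {S x y} → S ⊑ X → x ∈ X → y ∈ X → T (monoVisibleᵇ n S x y)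
  visibility-checked {x = x} {y} S⊑X x∈X y∈X =
    monoVisibleᵇ-complete n (distance-≤-dim x y) S⊑X (mv x∈X y∈X)

  blockedPairs-sound : ∀ {S v} xs → S ⊑ X → All (_∈ X) xs → ¬ T (blockedPairs S v xs)
  blockedPairs-sound (x ∷ xs) S⊑X (x∈X ∷ xs⊆X) t with to T-∨ t
  ... | inj₁ t-x = ¬T-any xs⊆X
    (λ y∈X t-xy → T-not⇒¬T (proj₂ (to T-∧ t-xy)) (visibility-checked S⊑X x∈X y∈X)) t-x
  ... | inj₂ t-xs = blockedPairs-sound xs S⊑X xs⊆X t-xs

  blocked-sound : ∀ {S v xs} → S ⊑ X → v ∈ X → All (_∈ X) xs → ¬ T (blocked S v xs)
  blocked-sound {xs = xs} S⊑X v∈X xs⊆X t with to T-∨ t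
  ... | inj₁ t-v = ¬T-any xs⊆X (λ x∈X t-x → T-not⇒¬T t-x (visibility-checked S⊑X x∈X v∈X)) t-v
  ... | inj₂ t-xs = blockedPairs-sound xs S⊑X xs⊆X t-xs

  search-sound : ∀ ds rest {S xs} → S ⊑ X → All (_∈ X) xs → All (CanMeet X rest) ds →
    ¬ T (search ds rest S xs)
  search-sound ds [] _ _ canMeet t = ¬T-any canMeet (λ {d} → unmet-sound {X = X} [] d) t
  search-sound ds (v ∷ rest) S⊑X xs⊆X canMeet t with to T-∨ t
  ... | inj₁ t-unmet = ¬T-any canMeet (λ {d} → unmet-sound {X = X} (v ∷ rest) d) t-unmet
  ... | inj₂ t-branches with to T-∧ t-branches | v ∈? X
  ... | _ , t-skip | no v∉X =
    search-sound ds rest S⊑X xs⊆X (All.map (canMeet-skip _ v∉X) canMeet) t-skip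
  ... | t-choose , _ | yes v∈X with to T-∨ t-choose
  ...   | inj₁ t-blocked = blocked-sound (insert-⊑ v∈X S⊑X) v∈X xs⊆X t-blocked
  ...   | inj₂ t-search = search-sound (map (choose v) ds) rest (insert-⊑ v∈X S⊑X) (v∈X ∷ xs⊆X)
    (map⁺ (All.map (canMeet-choose _ v∈X) canMeet)) t-search

canMeet-complete : ∀ {n} {X L : List (V n)} → Unique X → (∀ v → v ∈ L) →
  ∀ d → MeetsDemand X d → CanMeet X L d
canMeet-complete {X = X} {L} unique complete (p , k) meets =
  ≤-trans meets (unique-⊆⇒length-≤ (Unique.filter⁺ (T? ∘ p) unique) embed)
  where
    embed : ∀ {v} → v ∈ filterᵇ p X → v ∈ filter (inside? X p) L
    embed {v} v∈ = ∈-filter⁺ (inside? X p) (complete v) (∈-filter⁻ (T? ∘ p) v∈)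

search-refutes : ∀ {n} {X : List (V n)} ds L → Unique X → MonoMutualVisibility X → (∀ v → v ∈ L) →
  All (MeetsDemand X) ds → search ds L (empty n) [] ≢ true
search-refutes ds L unique mv complete meets =
  search-sound mv ds L empty-⊑ [] (All.map (canMeet-complete unique complete _) meets) ∘ from T-≡

onSide : ∀ {n} → Fin n → Bool → V n → Bool
onSide i true v = lookup v i
onSide i false v = not (lookup v i)

majority-side : ∀ {n} k (i : Fin n) (X : List (V n)) → k + k < length X →
  ∃ λ a → k < length (filterᵇ (onSide i a) X)
majority-side k i X big
  with pigeonhole k (subst (k + k <_) (length-filterᵇ-split (onSide i true) X) big)
... | inj₁ k<t = true , k<t
... | inj₂ k<f = false , k<f

-- All vertices, starting with c: the search then first tries vertices on the demanded sides.
verticesFrom : ∀ {n} → V n → List (V n)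
verticesFrom [] = [] ∷ []
verticesFrom (b ∷ c) = map (b ∷_) (verticesFrom c) ++ map (not b ∷_) (verticesFrom c)

∈-verticesFrom : ∀ {n} (c v : V n) → v ∈ verticesFrom c
∈-verticesFrom [] [] = here refl
∈-verticesFrom (false ∷ c) (false ∷ v) = ∈-++⁺ˡ (∈-map⁺ (false ∷_) (∈-verticesFrom c v))
∈-verticesFrom (true ∷ c) (true ∷ v) = ∈-++⁺ˡ (∈-map⁺ (true ∷_) (∈-verticesFrom c v))
∈-verticesFrom (false ∷ c) (true ∷ v) = ∈-++⁺ʳ _ (∈-map⁺ (true ∷_) (∈-verticesFrom c v))
∈-verticesFrom (true ∷ c) (false ∷ v) = ∈-++⁺ʳ _ (∈-map⁺ (false ∷_) (∈-verticesFrom c v))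

-- A set of 17 vertices of Q_5 has at least 9 on one side of each of the first two coordinates.
Q5-demands : Bool → Bool → List (Demand 5)
Q5-demands a b = ((λ _ → true) , 17) ∷ (onSide zero a , 9) ∷ (onSide (suc zero) b , 9) ∷ []

Q5-start : Bool → Bool → V 5
Q5-start a b = a ∷ b ∷ false ∷ false ∷ false ∷ []

-- Stated with _≡_ rather than T: the type checker evaluates T (search …) far more slowly.
Q5-search : ∀ a b → search (Q5-demands a b) (verticesFrom (Q5-start a b)) (empty 5) [] ≡ true
Q5-search false false = refl
Q5-search false true = refl
Q5-search true false = refl
Q5-search true true = refl

Q5-bound : (X : List (V 5)) → Unique X → MonoMutualVisibility X → length X ≤ 16
Q5-bound X unique mv = ≮⇒≥ refute
  where
    refute : 16 < length X → ⊥
    refute big with majority-side 8 zero X big | majority-side 8 (suc zero) X big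
    ... | a , side₀ | b , side₁ =
      search-refutes (Q5-demands a b) (verticesFrom (Q5-start a b)) unique mv
        (∈-verticesFrom (Q5-start a b))
        (total ∷ side₀ ∷ side₁ ∷ []) (Q5-search a b)
      where
        total : 17 ≤ length (filterᵇ (λ _ → true) X)
        total = subst (17 ≤_) (sym (cong length (filter-all (T? ∘ λ _ → true) (All.universal _ X))))
          big

monoMutualVisibility-bound : ∀ k (X : List (V (5 + k))) → Unique X → MonoMutualVisibility X →
  length X ≤ 2 ^ (4 + k)
monoMutualVisibility-bound zero = Q5-bound
monoMutualVisibility-bound (suc k) = double-bound (monoMutualVisibility-bound k)

corollary2 : (d : ℕ) → 5 ≤ d → (X : List (V d)) → Unique X →
    MutualVisibility X → length X ≤ 2 ^ (d ∸ 1)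
corollary2 d 5≤d X unique mv with m≤n⇒∃[o]m+o≡n 5≤d
... | k , refl = monoMutualVisibility-bound k X unique (mutualVisibility⇒mono mv)
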